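{- For every finite loopless multigraph $G$, the regularization $R(G)$ satisfies $\omega(G)\le\omega(R(G))\le\max(\omega(G),\Delta(G))$ and $\Delta(R(G))=\max(\Delta(G),\omega(G))$.
   Context: All multigraphs are finite and loopless (parallel edges allowed). $\Delta(G)$ is the maximum vertex degree of $G$ and $\deg_G(x)$ the degree of $x$. The density is $\omega(G)=\max_{H}\left\lceil \frac{e(H)}{\lfloor v(H)/2\rfloor}\right\rceil$, the maximum over sub-multigraphs $H\subseteq G$ with $v(H)\ge 2$ vertices, where $v(H)$, $e(H)$ are the numbers of vertices and edges of $H$. The regularization $R(G)$ of $G=(V,E)$ is defined as follows: if $G$ is regular and $\omega(G)\le\Delta(G)$, then $R(G)=G$. Otherwise, take a disjoint isomorphic copy $G'=(V',E')$ of $G$ with isomorphism $f:V\to V'$; let $R(G)$ have vertex set $V\cup V'$ and edge multiset $E\cup E'$ together with, for every $x\in V$, $\max(\Delta(G),\omega(G))-\deg_G(x)$ additional parallel edges joining $x$ and $f(x)$. -}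

module Defs where

open import Data.Nat using (_≤?_; ℕ; zero; suc; _+_; _∸_; _⊔_; _≤_; _<ᵇ_; ⌊_/2⌋)
open import Data.Nat.DivMod using (_/_)
open import Data.Bool using (Bool; true; false; if_then_else_; _∧_)
open import Data.Fin using (Fin; toℕ; splitAt; _≟_)
import Data.Fin as Fin
open import Data.Fin.Properties using (all?)
open import Data.Sum using (inj₁; inj₂)
open import Relation.Binary.PropositionalEquality using (_≡_; _≢_)
open import Relation.Nullary using (Dec; yes; no; does)
import Data.Nat.Properties as ℕP
open import Data.Product using (_×_)

∑ : ∀ {n} → (Fin n → ℕ) → ℕ
∑ {zero}  f = 0
∑ {suc n} f = f Fin.zero + ∑ (λ i → f (Fin.suc i))

maxF : ∀ {n} → (Fin n → ℕ) → ℕ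
maxF {zero}  f = 0
maxF {suc n} f = f Fin.zero ⊔ maxF (λ i → f (Fin.suc i))

-- The field μ i j is
-- only consulted for toℕ i < toℕ j: it is the number of parallel edges
-- joining i and j.
record Multigraph : Set where
  field
    n : ℕ
    μ : Fin n → Fin n → ℕ
open Multigraph public

symm : ∀ {n} → (Fin n → Fin n → ℕ) → Fin n → Fin n → ℕ
symm ν i j =
  if toℕ i <ᵇ toℕ j then ν i j else (if toℕ j <ᵇ toℕ i then ν j i else 0)

mult : (G : Multigraph) → Fin (n G) → Fin (n G) → ℕ
mult G = symm (μ G)

edges : ∀ {n} → (Fin n → Fin n → ℕ) → ℕ
edges ν = ∑ (λ i → ∑ (λ j → if toℕ i <ᵇ toℕ j then ν i j else 0))

e : Multigraph → ℕ
e G = edges (μ G)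

v : Multigraph → ℕ
v G = n G

deg : (G : Multigraph) → Fin (n G) → ℕ
deg G x = ∑ (λ y → mult G y x)

Δ : Multigraph → ℕ
Δ G = maxF (deg G)

Regular : Multigraph → Set
Regular G = ∀ x y → deg G x ≡ deg G y

regular? : (G : Multigraph) → Dec (Regular G)
regular? G = all? (λ x → all? (λ y → deg G x ℕP.≟ deg G y))

record SubMultigraph (G : Multigraph) : Set where
  field
    inV   : Fin (n G) → Bool
    ν     : Fin (n G) → Fin (n G) → ℕ
    ν≤    : ∀ i j → symm ν i j ≤ mult G i j
    ends  : ∀ i j → symm ν i j ≢ 0 → (inV i ∧ inV j) ≡ true
open SubMultigraph public

vH : ∀ {G} → SubMultigraph G → ℕ
vH H = ∑ (λ i → if inV H i then 1 else 0)

eH : ∀ {G} → SubMultigraph G → ℕ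
eH H = edges (ν H)

-- ceiling division ⌈ a / b ⌉ (only used for b ≥ 1; value 0 for b = 0)
ceilDiv : ℕ → ℕ → ℕ
ceilDiv a zero    = 0
ceilDiv a (suc k) = (a + k) / suc k

ratio : ∀ {G} → SubMultigraph G → ℕ
ratio H = ceilDiv (eH H) ⌊ vH H /2⌋

DensityBound : Multigraph → ℕ → Set
DensityBound G w = ∀ (H : SubMultigraph G) → 2 ≤ vH H → ratio H ≤ w

-- ω(G) = w : w is the maximum (least upper bound in ℕ; 0 if there is no
-- sub-multigraph with ≥ 2 vertices) of the ratios above.
IsDensity : Multigraph → ℕ → Set
IsDensity G w = DensityBound G w × (∀ b → DensityBound G b → w ≤ b)

doubled : Multigraph → ℕ → Multigraph
doubled G D = record { n = n G + n G ; μ = μ' }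
  where
  μ' : Fin (n G + n G) → Fin (n G + n G) → ℕ
  μ' a b with splitAt (n G) a | splitAt (n G) b
  ... | inj₁ x | inj₁ y = μ G x y
  ... | inj₂ x | inj₂ y = μ G x y
  ... | inj₁ x | inj₂ y = if does (x ≟ y) then D ∸ deg G x else 0
  ... | inj₂ x | inj₁ y = 0

R : Multigraph → ℕ → Multigraph
R G w with regular? G | w ≤? Δ G
... | yes _ | yes _ = G
... | _     | _     = doubled G (Δ G ⊔ w)

-- Let D = Δ(G) ⊔ ω(G). Density bounds need only be checked on induced
-- sub-multigraphs, where a bound b reads: twice the number of edges inside X is at
-- most 2b⌊|X|/2⌋. In the doubled graph every vertex has degree exactly D, so its
-- maximum degree is D; and G is the induced sub-multigraph on the first copy, so
-- ω(G) ≤ ω(R(G)). Conversely, let S meet the two copies in A and B. Edges of S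
-- inside a copy lie in A ∖ B or in B ∖ A, where the density of G gives the bound,
-- or have an endpoint in A ∩ B. A vertex of A ∩ B stands for two vertices of S and
-- meets at most deg x such edges plus D ∸ deg x edges to its twin, that is D per
-- vertex; since |S| = |A ∖ B| + |B ∖ A| + 2|A ∩ B| this gives ω(R(G)) ≤ D.

module Submission where

open import Defs
open import Data.Bool using (Bool; true; false; if_then_else_; _∧_; not)
open import Data.Bool.Properties using (∧-comm; ∧-zeroʳ)
open import Data.Empty using (⊥-elim)
open import Data.Fin using (Fin; zero; suc; toℕ; splitAt; _≟_; _↑ˡ_; _↑ʳ_)
open import Data.Fin.Properties
  using (toℕ<n; toℕ-injective; toℕ-↑ˡ; toℕ-↑ʳ; splitAt-↑ˡ; splitAt-↑ʳ; splitAt⁻¹-↑ˡ; splitAt⁻¹-↑ʳ)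
open import Data.Nat
  using (ℕ; zero; suc; _+_; _*_; _∸_; _⊔_; _≤_; _<_; z≤n; s≤s; s≤s⁻¹; _<ᵇ_; ⌊_/2⌋; _≤?_; _<?_)
open import Data.Nat.DivMod using (_/_; _%_; m≡m%n+[m/n]*n; m%n<n; m<n*o⇒m/o<n)
open import Data.Nat.Properties hiding (_≟_)
open import Data.Nat.Tactic.RingSolver using (solve-∀)
open import Algebra.Properties.CommutativeSemigroup +-commutativeSemigroup using (interchange)
open import Data.Product using (_×_; _,_; proj₁; proj₂)
open import Data.Sum using (inj₁; inj₂; [_,_]′)
open import Function using (_∘_; const; flip)
open import Relation.Binary.Definitions using (tri<; tri≈; tri>)
open import Relation.Binary.PropositionalEquality
open import Relation.Nullary using (yes; no; does; ¬_)

infix 8 _when_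

_when_ : ℕ → Bool → ℕ
m when b = if b then m else 0

0-when : ∀ b → 0 when b ≡ 0
0-when true  = refl
0-when false = refl

when-≤ : ∀ m b → m when b ≤ m
when-≤ m true  = ≤-refl
when-≤ m false = z≤n

when-≢0 : ∀ {m} b → m when b ≢ 0 → b ≡ true
when-≢0 true  _    = refl
when-≢0 false ≢0 = ⊥-elim (≢0 refl)

≤-when : ∀ {x m} b → x ≤ m → (x ≢ 0 → b ≡ true) → x ≤ m when b
≤-when         true  x≤m _     = x≤m
≤-when {zero}  false _   _     = z≤n
≤-when {suc x} false _   x≢0⇒b with x≢0⇒b (λ ())
... | ()

when-comm : ∀ m b c → (m when b) when c ≡ (m when c) when b
when-comm m true  c     = refl
when-comm m false true  = refl
when-comm m false false = refl

∑₂ : ∀ {m k} → (Fin m → Fin k → ℕ) → ℕ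
∑₂ f = ∑ λ i → ∑ (f i)

∑-cong : ∀ {n} {f g : Fin n → ℕ} → (∀ i → f i ≡ g i) → ∑ f ≡ ∑ g
∑-cong {zero}  f≗g = refl
∑-cong {suc n} f≗g = cong₂ _+_ (f≗g zero) (∑-cong (f≗g ∘ suc))

∑-mono : ∀ {n} {f g : Fin n → ℕ} → (∀ i → f i ≤ g i) → ∑ f ≤ ∑ g
∑-mono {zero}  f≤g = z≤n
∑-mono {suc n} f≤g = +-mono-≤ (f≤g zero) (∑-mono (f≤g ∘ suc))

∑-zero : ∀ n → ∑ {n} (const 0) ≡ 0
∑-zero zero    = refl
∑-zero (suc n) = ∑-zero n

∑-distrib-+ : ∀ {n} (f g : Fin n → ℕ) → ∑ (λ i → f i + g i) ≡ ∑ f + ∑ g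
∑-distrib-+ {zero}  f g = refl
∑-distrib-+ {suc n} f g =
  trans (cong (f zero + g zero +_) (∑-distrib-+ (f ∘ suc) (g ∘ suc))) (interchange (f zero) (g zero) _ _)

*-distribˡ-∑ : ∀ {n} c (f : Fin n → ℕ) → c * ∑ f ≡ ∑ (λ i → c * f i)
*-distribˡ-∑ {zero}  c f = *-zeroʳ c
*-distribˡ-∑ {suc n} c f =
  trans (*-distribˡ-+ c (f zero) _) (cong (c * f zero +_) (*-distribˡ-∑ c (f ∘ suc)))

∑-comm : ∀ {m k} (f : Fin m → Fin k → ℕ) → ∑₂ f ≡ ∑₂ (flip f)
∑-comm {zero}  {k} f = sym (∑-zero k)
∑-comm {suc m}     f = trans (cong (∑ (f zero) +_) (∑-comm (f ∘ suc))) (sym (∑-distrib-+ (f zero) _))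

∑-when : ∀ {n} b (f : Fin n → ℕ) → ∑ (λ i → f i when b) ≡ ∑ f when b
∑-when     true  f = refl
∑-when {n} false f = ∑-zero n

∑-pick : ∀ {n} (x : Fin n) (g : Fin n → ℕ) → ∑ (λ y → g y when does (x ≟ y)) ≡ g x
∑-pick {suc n} zero    g = trans (cong (g zero +_) (∑-zero n)) (+-identityʳ _)
∑-pick         (suc x) g = ∑-pick x (g ∘ suc)

∑-pick′ : ∀ {n} (x : Fin n) (g : Fin n → ℕ) → ∑ (λ y → g y when does (y ≟ x)) ≡ g x
∑-pick′ {suc n} zero    g = trans (cong (g zero +_) (∑-zero n)) (+-identityʳ _)
∑-pick′         (suc x) g = ∑-pick′ x (g ∘ suc)

≤∑ : ∀ {n} (f : Fin n → ℕ) i → f i ≤ ∑ f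
≤∑ f zero    = m≤m+n _ _
≤∑ f (suc i) = ≤-trans (≤∑ (f ∘ suc) i) (m≤n+m _ _)

pair≤∑ : ∀ {n} (f : Fin n → ℕ) i j → i ≢ j → f i + f j ≤ ∑ f
pair≤∑ f zero    zero    i≢j = ⊥-elim (i≢j refl)
pair≤∑ f zero    (suc j) _   = +-monoʳ-≤ (f zero) (≤∑ (f ∘ suc) j)
pair≤∑ f (suc i) zero    _   = subst (_≤ ∑ f) (+-comm (f zero) _) (pair≤∑ f zero (suc i) λ ())
pair≤∑ f (suc i) (suc j) i≢j = ≤-trans (pair≤∑ (f ∘ suc) i j (i≢j ∘ cong suc)) (m≤n+m _ _)

∑-split : ∀ m k (f : Fin (m + k) → ℕ) → ∑ f ≡ ∑ (f ∘ (_↑ˡ k)) + ∑ (f ∘ (m ↑ʳ_))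
∑-split zero    k f = refl
∑-split (suc m) k f = trans (cong (f zero +_) (∑-split m k (f ∘ suc))) (sym (+-assoc (f zero) _ _))

∑₂-cong : ∀ {m k} {f g : Fin m → Fin k → ℕ} → (∀ i j → f i j ≡ g i j) → ∑₂ f ≡ ∑₂ g
∑₂-cong f≗g = ∑-cong (∑-cong ∘ f≗g)

∑₂-mono : ∀ {m k} {f g : Fin m → Fin k → ℕ} → (∀ i j → f i j ≤ g i j) → ∑₂ f ≤ ∑₂ g
∑₂-mono f≤g = ∑-mono (∑-mono ∘ f≤g)

∑₂-zero : ∀ m k → ∑₂ {m} {k} (λ _ _ → 0) ≡ 0
∑₂-zero m k = trans (∑-cong {m} (λ _ → ∑-zero k)) (∑-zero m)

∑₂-distrib-+ : ∀ {m k} (f g : Fin m → Fin k → ℕ) → ∑₂ (λ i j → f i j + g i j) ≡ ∑₂ f + ∑₂ g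
∑₂-distrib-+ f g = trans (∑-cong (λ i → ∑-distrib-+ (f i) (g i))) (∑-distrib-+ (∑ ∘ f) (∑ ∘ g))

∑₂-split : ∀ m k (f : Fin (m + k) → Fin (m + k) → ℕ) →
  ∑₂ f ≡ (∑₂ (λ x y → f (x ↑ˡ k) (y ↑ˡ k)) + ∑₂ (λ x y → f (x ↑ˡ k) (m ↑ʳ y)))
       + (∑₂ (λ x y → f (m ↑ʳ x) (y ↑ˡ k)) + ∑₂ (λ x y → f (m ↑ʳ x) (m ↑ʳ y)))
∑₂-split m k f = trans (∑-split m k (∑ ∘ f)) (cong₂ _+_ (rows (_↑ˡ k)) (rows (m ↑ʳ_)))
  where
  rows : ∀ {l} (g : Fin l → Fin (m + k)) →
    ∑ (∑ ∘ f ∘ g) ≡ ∑₂ (λ x y → f (g x) (y ↑ˡ k)) + ∑₂ (λ x y → f (g x) (m ↑ʳ y))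
  rows g = trans (∑-cong (λ x → ∑-split m k (f (g x))))
    (∑-distrib-+ (λ x → ∑ λ y → f (g x) (y ↑ˡ k)) (λ x → ∑ λ y → f (g x) (m ↑ʳ y)))

≤maxF : ∀ {n} (f : Fin n → ℕ) i → f i ≤ maxF f
≤maxF f zero    = m≤m⊔n _ _
≤maxF f (suc i) = ≤-trans (≤maxF (f ∘ suc) i) (m≤n⊔m _ _)

maxF-lub : ∀ {n} (f : Fin n → ℕ) {c} → (∀ i → f i ≤ c) → maxF f ≤ c
maxF-lub {zero}  f f≤c = z≤n
maxF-lub {suc n} f f≤c = ⊔-lub (f≤c zero) (maxF-lub (f ∘ suc) (f≤c ∘ suc))

maxF-const : ∀ {n} (f : Fin n → ℕ) {c} → (∀ i → f i ≡ c) → Fin n → maxF f ≡ c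
maxF-const f f≡c i = ≤-antisym (maxF-lub f (≤-reflexive ∘ f≡c)) (subst (_≤ maxF f) (f≡c i) (≤maxF f i))

↑-elim : ∀ {m k} {P : Fin (m + k) → Set} → (∀ x → P (x ↑ˡ k)) → (∀ y → P (m ↑ʳ y)) → ∀ a → P a
↑-elim {m} {P = P} left right a with splitAt m a in eq
... | inj₁ x = subst P (splitAt⁻¹-↑ˡ eq) (left x)
... | inj₂ y = subst P (splitAt⁻¹-↑ʳ eq) (right y)

↑ˡ-mono : ∀ {m} k {a b : Fin m} → toℕ a < toℕ b → toℕ (a ↑ˡ k) < toℕ (b ↑ˡ k)
↑ˡ-mono k {a} {b} a<b rewrite toℕ-↑ˡ a k | toℕ-↑ˡ b k = a<b

↑ʳ-mono : ∀ {k} m {a b : Fin k} → toℕ a < toℕ b → toℕ (m ↑ʳ a) < toℕ (m ↑ʳ b)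
↑ʳ-mono m {a} {b} a<b rewrite toℕ-↑ʳ m a | toℕ-↑ʳ m b = +-monoʳ-< m a<b

↑ˡ<↑ʳ : ∀ {m k} (x : Fin m) (y : Fin k) → toℕ (x ↑ˡ k) < toℕ (m ↑ʳ y)
↑ˡ<↑ʳ {m} {k} x y rewrite toℕ-↑ˡ x k | toℕ-↑ʳ m y = ≤-trans (toℕ<n x) (m≤m+n m (toℕ y))

<ᵇ-true : ∀ {m n} → m < n → (m <ᵇ n) ≡ true
<ᵇ-true {zero}  (s≤s _)   = refl
<ᵇ-true {suc m} (s≤s m<n) = <ᵇ-true m<n

<ᵇ-false : ∀ {m n} → n ≤ m → (m <ᵇ n) ≡ false
<ᵇ-false z≤n       = refl
<ᵇ-false (s≤s n≤m) = <ᵇ-false n≤m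

symm-< : ∀ {n} (ν : Fin n → Fin n → ℕ) {i j} → toℕ i < toℕ j → symm ν i j ≡ ν i j
symm-< ν i<j rewrite <ᵇ-true i<j = refl

symm-> : ∀ {n} (ν : Fin n → Fin n → ℕ) {i j} → toℕ j < toℕ i → symm ν i j ≡ ν j i
symm-> ν j<i rewrite <ᵇ-false (<⇒≤ j<i) | <ᵇ-true j<i = refl

symm-diag : ∀ {n} (ν : Fin n → Fin n → ℕ) i → symm ν i i ≡ 0
symm-diag ν i rewrite <ᵇ-false (≤-refl {toℕ i}) = refl

symm-sym : ∀ {n} (ν : Fin n → Fin n → ℕ) i j → symm ν i j ≡ symm ν j i
symm-sym ν i j with <-cmp (toℕ i) (toℕ j)
... | tri< i<j _ _ = trans (symm-< ν i<j) (sym (symm-> ν i<j))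
... | tri≈ _ i≡j _ rewrite toℕ-injective i≡j = refl
... | tri> _ _ j<i = trans (symm-> ν j<i) (sym (symm-< ν j<i))

symm-halves : ∀ {n} (ν : Fin n → Fin n → ℕ) i j →
  symm ν i j ≡ ν i j when (toℕ i <ᵇ toℕ j) + ν j i when (toℕ j <ᵇ toℕ i)
symm-halves ν i j with <-cmp (toℕ i) (toℕ j)
... | tri< i<j _ _ rewrite <ᵇ-true i<j | <ᵇ-false (<⇒≤ i<j) = sym (+-identityʳ _)
... | tri≈ _ i≡j _ rewrite toℕ-injective i≡j | <ᵇ-false (≤-refl {toℕ j}) = refl
... | tri> _ _ j<i rewrite <ᵇ-false (<⇒≤ j<i) | <ᵇ-true j<i = refl

∑₂-symm : ∀ {n} (ν : Fin n → Fin n → ℕ) → ∑₂ (symm ν) ≡ 2 * edges ν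
∑₂-symm {n} ν = begin
  ∑₂ (symm ν)                         ≡⟨ ∑₂-cong (symm-halves ν) ⟩
  ∑₂ (λ i j → upper i j + upper j i)  ≡⟨ ∑₂-distrib-+ upper (flip upper) ⟩
  edges ν + ∑₂ (flip upper)           ≡⟨ cong (edges ν +_) (sym (∑-comm upper)) ⟩
  edges ν + edges ν                   ≡⟨ cong (edges ν +_) (sym (+-identityʳ _)) ⟩
  2 * edges ν                         ∎
  where
  open ≡-Reasoning
  upper : Fin n → Fin n → ℕ
  upper i j = ν i j when (toℕ i <ᵇ toℕ j)

symm-when : ∀ {n} (ν : Fin n → Fin n → ℕ) (c : Fin n → Fin n → Bool) → (∀ i j → c i j ≡ c j i) →
  ∀ i j → symm (λ a b → ν a b when c a b) i j ≡ symm ν i j when c i j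
symm-when ν c c-sym i j with <-cmp (toℕ i) (toℕ j)
... | tri< i<j _ _ =
  trans (symm-< (λ a b → ν a b when c a b) i<j) (cong (_when c i j) (sym (symm-< ν i<j)))
... | tri≈ _ i≡j _ rewrite toℕ-injective i≡j =
  trans (symm-diag (λ a b → ν a b when c a b) j)
    (sym (trans (cong (_when c j j) (symm-diag ν j)) (0-when (c j j))))
... | tri> _ _ j<i =
  trans (symm-> (λ a b → ν a b when c a b) j<i)
    (trans (cong (ν j i when_) (c-sym j i)) (cong (_when c i j) (sym (symm-> ν j<i))))

symm-reindex : ∀ {m n} (ν : Fin n → Fin n → ℕ) (ν′ : Fin m → Fin m → ℕ) (f : Fin m → Fin n) →
  (∀ {a b} → toℕ a < toℕ b → toℕ (f a) < toℕ (f b)) → (∀ a b → ν (f a) (f b) ≡ ν′ a b) →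
  ∀ x y → symm ν (f x) (f y) ≡ symm ν′ x y
symm-reindex ν ν′ f f-mono ν∘f x y with <-cmp (toℕ x) (toℕ y)
... | tri< x<y _ _ = trans (symm-< ν (f-mono x<y)) (trans (ν∘f x y) (sym (symm-< ν′ x<y)))
... | tri≈ _ x≡y _ rewrite toℕ-injective x≡y = trans (symm-diag ν (f y)) (sym (symm-diag ν′ y))
... | tri> _ _ y<x = trans (symm-> ν (f-mono y<x)) (trans (ν∘f y x) (sym (symm-> ν′ y<x)))

infixr 7 _∩_ _∖_

_∩_ : ∀ {n} → (Fin n → Bool) → (Fin n → Bool) → Fin n → Bool
(X ∩ Y) i = X i ∧ Y i

_∖_ : ∀ {n} → (Fin n → Bool) → (Fin n → Bool) → Fin n → Bool
(X ∖ Y) i = X i ∧ not (Y i)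

size : ∀ {n} → (Fin n → Bool) → ℕ
size X = ∑ λ i → 1 when X i

size-overlap : ∀ {n} (A B : Fin n → Bool) →
  size A + size B ≡ (size (A ∖ B) + size (B ∖ A)) + (size (A ∩ B) + size (A ∩ B))
size-overlap {n} A B =
  trans (sym (∑-distrib-+ (ind A) (ind B)))
    (trans (∑-cong λ x → split (A x) (B x))
      (trans (∑-distrib-+ (λ x → ind (A ∖ B) x + ind (B ∖ A) x) (λ x → ind (A ∩ B) x + ind (A ∩ B) x))
        (cong₂ _+_ (∑-distrib-+ (ind (A ∖ B)) (ind (B ∖ A))) (∑-distrib-+ (ind (A ∩ B)) (ind (A ∩ B))))))
  where
  ind : (Fin n → Bool) → Fin n → ℕ
  ind X x = 1 when X x

  split : ∀ a b →
    1 when a + 1 when b ≡ (1 when (a ∧ not b) + 1 when (b ∧ not a)) + (1 when (a ∧ b) + 1 when (a ∧ b))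
  split true  true  = refl
  split true  false = refl
  split false true  = refl
  split false false = refl

⌊m/2⌋+⌊n/2⌋≤⌊m+n/2⌋ : ∀ m n → ⌊ m /2⌋ + ⌊ n /2⌋ ≤ ⌊ m + n /2⌋
⌊m/2⌋+⌊n/2⌋≤⌊m+n/2⌋ zero          n = ≤-refl
⌊m/2⌋+⌊n/2⌋≤⌊m+n/2⌋ (suc zero)    n = ⌊n/2⌋-mono (n≤1+n n)
⌊m/2⌋+⌊n/2⌋≤⌊m+n/2⌋ (suc (suc m)) n = s≤s (⌊m/2⌋+⌊n/2⌋≤⌊m+n/2⌋ m n)

⌊[n+n]+m/2⌋≡n+⌊m/2⌋ : ∀ n m → ⌊ (n + n) + m /2⌋ ≡ n + ⌊ m /2⌋
⌊[n+n]+m/2⌋≡n+⌊m/2⌋ zero    m = refl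
⌊[n+n]+m/2⌋≡n+⌊m/2⌋ (suc n) m rewrite +-suc n n = cong suc (⌊[n+n]+m/2⌋≡n+⌊m/2⌋ n m)

ceilDiv≤⇒≤* : ∀ a b {d} → 0 < d → ceilDiv a d ≤ b → a ≤ b * d
ceilDiv≤⇒≤* a b {suc k} _ ceil≤b = +-cancelʳ-≤ k a (b * suc k) (begin
  a + k                                       ≡⟨ m≡m%n+[m/n]*n (a + k) (suc k) ⟩
  (a + k) % suc k + (a + k) / suc k * suc k
    ≤⟨ +-mono-≤ (s≤s⁻¹ (m%n<n (a + k) (suc k))) (*-monoˡ-≤ (suc k) ceil≤b) ⟩
  k + b * suc k                               ≡⟨ +-comm k _ ⟩
  b * suc k + k                               ∎)
  where open ≤-Reasoning

≤*⇒ceilDiv≤ : ∀ a b {d} → 0 < d → a ≤ b * d → ceilDiv a d ≤ b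
≤*⇒ceilDiv≤ a b {suc k} _ a≤bd = s≤s⁻¹ (m<n*o⇒m/o<n {a + k} {suc b} {suc k} (begin-strict
  a + k              ≤⟨ +-monoˡ-≤ k a≤bd ⟩
  b * suc k + k      <⟨ +-monoʳ-< (b * suc k) (n<1+n k) ⟩
  b * suc k + suc k  ≡⟨ +-comm (b * suc k) (suc k) ⟩
  suc b * suc k      ∎))
  where open ≤-Reasoning

multIn : (G : Multigraph) → (Fin (n G) → Bool) → Fin (n G) → Fin (n G) → ℕ
multIn G X x y = mult G x y when (X x ∧ X y)

inducedDegreeSum : (G : Multigraph) → (Fin (n G) → Bool) → ℕ
inducedDegreeSum G X = ∑₂ (multIn G X)

vol : (G : Multigraph) → (Fin (n G) → Bool) → ℕ
vol G X = ∑ λ x → deg G x when X x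

deficit : (G : Multigraph) → ℕ → (Fin (n G) → Bool) → ℕ
deficit G D X = ∑ λ x → (D ∸ deg G x) when X x

symm-restrict : ∀ G (X : Fin (n G) → Bool) i j →
  symm (λ a b → μ G a b when (X a ∧ X b)) i j ≡ multIn G X i j
symm-restrict G X = symm-when (μ G) (λ a b → X a ∧ X b) (λ a b → ∧-comm (X a) (X b))

induced : (G : Multigraph) → (Fin (n G) → Bool) → SubMultigraph G
induced G X = record
  { inV  = X
  ; ν    = λ i j → μ G i j when (X i ∧ X j)
  ; ν≤   = λ i j → subst (_≤ mult G i j) (sym (symm-restrict G X i j)) (when-≤ (mult G i j) (X i ∧ X j))
  ; ends = λ i j ≢0 → when-≢0 (X i ∧ X j) (≢0 ∘ trans (symm-restrict G X i j))
  }

DegreeSumBound : Multigraph → ℕ → Set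
DegreeSumBound G b = ∀ X → inducedDegreeSum G X ≤ 2 * (b * ⌊ size X /2⌋)

module _ (G : Multigraph) where

  deg≤Δ : ∀ x → deg G x ≤ Δ G
  deg≤Δ = ≤maxF (deg G)

  inducedDegreeSum-cong : ∀ {X Y} → (∀ x → X x ≡ Y x) → inducedDegreeSum G X ≡ inducedDegreeSum G Y
  inducedDegreeSum-cong X≗Y = ∑₂-cong λ x y → cong₂ (λ a b → mult G x y when (a ∧ b)) (X≗Y x) (X≗Y y)

  2*eH-induced : ∀ X → 2 * eH (induced G X) ≡ inducedDegreeSum G X
  2*eH-induced X = trans (sym (∑₂-symm (ν (induced G X)))) (∑₂-cong (symm-restrict G X))

  2*eH≤inducedDegreeSum : (H : SubMultigraph G) → 2 * eH H ≤ inducedDegreeSum G (inV H)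
  2*eH≤inducedDegreeSum H =
    subst (_≤ inducedDegreeSum G (inV H)) (∑₂-symm (ν H))
      (∑₂-mono λ a b → ≤-when (inV H a ∧ inV H b) (ν≤ H a b) (ends H a b))

  inducedDegreeSum-small : ∀ X → size X < 2 → inducedDegreeSum G X ≡ 0
  inducedDegreeSum-small X size<2 = trans (∑₂-cong no-edge) (∑₂-zero (n G) (n G))
    where
    no-edge : ∀ x y → multIn G X x y ≡ 0
    no-edge x y with X x in Xx | X y in Xy
    ... | false | _     = refl
    ... | true  | false = refl
    ... | true  | true  with x ≟ y
    ...   | yes refl = symm-diag (μ G) x
    ...   | no  x≢y  = ⊥-elim (<⇒≱ size<2 (subst (_≤ size X)
                          (cong₂ _+_ (cong (1 when_) Xx) (cong (1 when_) Xy)) (pair≤∑ _ x y x≢y)))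

  densityBound⇒degreeSumBound : ∀ {b} → DensityBound G b → DegreeSumBound G b
  densityBound⇒degreeSumBound {b} bound X with size X <? 2
  ... | yes size<2 = subst (_≤ 2 * (b * ⌊ size X /2⌋)) (sym (inducedDegreeSum-small X size<2)) z≤n
  ... | no  size≮2 = subst (_≤ 2 * (b * ⌊ size X /2⌋)) (2*eH-induced X)
          (*-monoʳ-≤ 2 (ceilDiv≤⇒≤* _ b (⌊n/2⌋-mono 2≤size) (bound (induced G X) 2≤size)))
    where
    2≤size : 2 ≤ size X
    2≤size = ≮⇒≥ size≮2

  degreeSumBound⇒densityBound : ∀ {b} → DegreeSumBound G b → DensityBound G b
  degreeSumBound⇒densityBound {b} bound H 2≤v = ≤*⇒ceilDiv≤ (eH H) b (⌊n/2⌋-mono 2≤v)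
    (*-cancelˡ-≤ 2 (≤-trans (2*eH≤inducedDegreeSum H) (bound (inV H))))

  degreeSumBound-mono : ∀ {a b} → DegreeSumBound G a → a ≤ b → DegreeSumBound G b
  degreeSumBound-mono bound a≤b X = ≤-trans (bound X) (*-monoʳ-≤ 2 (*-monoˡ-≤ _ a≤b))

  vol-rows : ∀ X → ∑₂ (λ x y → mult G x y when X x) ≡ vol G X
  vol-rows X =
    ∑-cong λ x → trans (∑-when (X x) (mult G x)) (cong (_when X x) (∑-cong (symm-sym (μ G) x)))

  vol-columns : ∀ X → ∑₂ (λ x y → mult G x y when X y) ≡ vol G X
  vol-columns X =
    trans (∑-comm (λ x y → mult G x y when X y)) (∑-cong λ y → ∑-when (X y) (λ x → mult G x y))

  vol+deficit : ∀ {D} → (∀ x → deg G x ≤ D) → ∀ X → vol G X + deficit G D X ≡ D * size X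
  vol+deficit {D} deg≤D X =
    trans (sym (∑-distrib-+ (λ x → deg G x when X x) (λ x → (D ∸ deg G x) when X x)))
      (trans (∑-cong pointwise) (sym (*-distribˡ-∑ D (λ x → 1 when X x))))
    where
    pointwise : ∀ x → deg G x when X x + (D ∸ deg G x) when X x ≡ D * 1 when X x
    pointwise x with X x
    ... | true  = trans (m+[n∸m]≡n (deg≤D x)) (sym (*-identityʳ D))
    ... | false = sym (*-zeroʳ D)

  -- A pair counted on the left lies inside A ∖ B or inside B ∖ A,
  -- or else it is charged to each of its endpoints in A ∩ B.
  inducedDegreeSum-overlap : ∀ A B →
    inducedDegreeSum G A + inducedDegreeSum G B ≤
    (inducedDegreeSum G (A ∖ B) + inducedDegreeSum G (B ∖ A)) + (vol G (A ∩ B) + vol G (A ∩ B))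
  inducedDegreeSum-overlap A B =
    subst₂ _≤_ (∑₂-distrib-+ (multIn G A) (multIn G B))
      (trans (∑₂-distrib-+ (λ x y → multIn G (A ∖ B) x y + multIn G (B ∖ A) x y)
                           (λ x y → row x y + column x y))
        (cong₂ _+_ (∑₂-distrib-+ (multIn G (A ∖ B)) (multIn G (B ∖ A)))
          (trans (∑₂-distrib-+ row column) (cong₂ _+_ (vol-rows (A ∩ B)) (vol-columns (A ∩ B))))))
      (∑₂-mono λ x y → charge (A x) (B x) (A y) (B y) (mult G x y))
    where
    row column : Fin (n G) → Fin (n G) → ℕ
    row    x y = mult G x y when (A ∩ B) x
    column x y = mult G x y when (A ∩ B) y

    charge : ∀ a b a′ b′ m →
      m when (a ∧ a′) + m when (b ∧ b′) ≤
      (m when ((a ∧ not b) ∧ (a′ ∧ not b′)) + m when ((b ∧ not a) ∧ (b′ ∧ not a′)))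
        + (m when (a ∧ b) + m when (a′ ∧ b′))
    charge true  true  true  true  m = ≤-refl
    charge true  true  true  false m = ≤-refl
    charge true  true  false true  m = m≤m+n m 0
    charge true  true  false false m = z≤n
    charge true  false true  true  m = ≤-reflexive (+-identityʳ m)
    charge true  false true  false m = ≤-reflexive (sym (+-identityʳ _))
    charge true  false false _     m = z≤n
    charge false true  true  true  m = ≤-refl
    charge false true  true  false m = z≤n
    charge false true  false true  m = m≤m+n m 0
    charge false true  false false m = z≤n
    charge false false _     _     m = z≤n

module Doubled (G : Multigraph) (D : ℕ) where

  N : ℕ
  N = n G

  G₂ : Multigraph
  G₂ = doubled G D

  left right : (Fin (N + N) → Bool) → Fin N → Bool
  left  S x = S (x ↑ˡ N)
  right S x = S (N ↑ʳ x)

  μ-↑ˡ↑ˡ : ∀ x y → μ G₂ (x ↑ˡ N) (y ↑ˡ N) ≡ μ G x y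
  μ-↑ˡ↑ˡ x y rewrite splitAt-↑ˡ N x N | splitAt-↑ˡ N y N = refl

  μ-↑ʳ↑ʳ : ∀ x y → μ G₂ (N ↑ʳ x) (N ↑ʳ y) ≡ μ G x y
  μ-↑ʳ↑ʳ x y rewrite splitAt-↑ʳ N N x | splitAt-↑ʳ N N y = refl

  μ-↑ˡ↑ʳ : ∀ x y → μ G₂ (x ↑ˡ N) (N ↑ʳ y) ≡ (D ∸ deg G x) when does (x ≟ y)
  μ-↑ˡ↑ʳ x y rewrite splitAt-↑ˡ N x N | splitAt-↑ʳ N N y = refl

  mult-↑ˡ↑ˡ : ∀ x y → mult G₂ (x ↑ˡ N) (y ↑ˡ N) ≡ mult G x y
  mult-↑ˡ↑ˡ = symm-reindex (μ G₂) (μ G) (_↑ˡ N) (↑ˡ-mono N) μ-↑ˡ↑ˡ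

  mult-↑ʳ↑ʳ : ∀ x y → mult G₂ (N ↑ʳ x) (N ↑ʳ y) ≡ mult G x y
  mult-↑ʳ↑ʳ = symm-reindex (μ G₂) (μ G) (N ↑ʳ_) (↑ʳ-mono N) μ-↑ʳ↑ʳ

  mult-↑ˡ↑ʳ : ∀ x y → mult G₂ (x ↑ˡ N) (N ↑ʳ y) ≡ (D ∸ deg G x) when does (x ≟ y)
  mult-↑ˡ↑ʳ x y = trans (symm-< (μ G₂) (↑ˡ<↑ʳ x y)) (μ-↑ˡ↑ʳ x y)

  mult-↑ʳ↑ˡ : ∀ x y → mult G₂ (N ↑ʳ x) (y ↑ˡ N) ≡ (D ∸ deg G y) when does (y ≟ x)
  mult-↑ʳ↑ˡ x y = trans (symm-> (μ G₂) (↑ˡ<↑ʳ y x)) (μ-↑ˡ↑ʳ y x)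

  module _ (Δ≤D : Δ G ≤ D) where

    deg≤D : ∀ x → deg G x ≤ D
    deg≤D x = ≤-trans (deg≤Δ G x) Δ≤D

    deg-↑ˡ : ∀ x → deg G₂ (x ↑ˡ N) ≡ D
    deg-↑ˡ x = begin
      deg G₂ (x ↑ˡ N)                                          ≡⟨ ∑-split N N _ ⟩
      ∑ (λ y → mult G₂ (y ↑ˡ N) (x ↑ˡ N)) + ∑ (λ y → mult G₂ (N ↑ʳ y) (x ↑ˡ N))
        ≡⟨ cong₂ _+_ (∑-cong (λ y → mult-↑ˡ↑ˡ y x)) (∑-cong (λ y → mult-↑ʳ↑ˡ y x)) ⟩
      deg G x + ∑ (λ y → (D ∸ deg G x) when does (x ≟ y))   ≡⟨ cong (deg G x +_) (∑-pick x _) ⟩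
      deg G x + (D ∸ deg G x)                                 ≡⟨ m+[n∸m]≡n (deg≤D x) ⟩
      D                                                       ∎
      where open ≡-Reasoning

    deg-↑ʳ : ∀ x → deg G₂ (N ↑ʳ x) ≡ D
    deg-↑ʳ x = begin
      deg G₂ (N ↑ʳ x)                                          ≡⟨ ∑-split N N _ ⟩
      ∑ (λ y → mult G₂ (y ↑ˡ N) (N ↑ʳ x)) + ∑ (λ y → mult G₂ (N ↑ʳ y) (N ↑ʳ x))
        ≡⟨ cong₂ _+_ (∑-cong (λ y → mult-↑ˡ↑ʳ y x)) (∑-cong (λ y → mult-↑ʳ↑ʳ y x)) ⟩
      ∑ (λ y → (D ∸ deg G y) when does (y ≟ x)) + deg G x   ≡⟨ cong (_+ deg G x) (∑-pick′ x _) ⟩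
      (D ∸ deg G x) + deg G x                                 ≡⟨ m∸n+n≡m (deg≤D x) ⟩
      D                                                       ∎
      where open ≡-Reasoning

    Δ-doubled : Fin N → Δ G₂ ≡ D
    Δ-doubled x = maxF-const (deg G₂) (↑-elim deg-↑ˡ deg-↑ʳ) (x ↑ˡ N)

  inducedDegreeSum-doubled : ∀ S →
    inducedDegreeSum G₂ S ≡
      (inducedDegreeSum G (left S) + deficit G D (left S ∩ right S))
      + (deficit G D (left S ∩ right S) + inducedDegreeSum G (right S))
  inducedDegreeSum-doubled S =
    trans (∑₂-split N N (λ a b → mult G₂ a b when (S a ∧ S b)))
      (cong₂ _+_
        (cong₂ _+_ (∑₂-cong λ x y → cong (_when (left S x ∧ left S y)) (mult-↑ˡ↑ˡ x y)) (∑-cong across))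
        (cong₂ _+_ (∑-cong across′) (∑₂-cong λ x y → cong (_when (right S x ∧ right S y)) (mult-↑ʳ↑ʳ x y))))
    where
    across : ∀ x → ∑ (λ y → mult G₂ (x ↑ˡ N) (N ↑ʳ y) when (left S x ∧ right S y))
                   ≡ (D ∸ deg G x) when (left S x ∧ right S x)
    across x =
      trans (∑-cong λ y → trans (cong (_when (left S x ∧ right S y)) (mult-↑ˡ↑ʳ x y))
                                (when-comm (D ∸ deg G x) (does (x ≟ y)) (left S x ∧ right S y)))
        (∑-pick x λ y → (D ∸ deg G x) when (left S x ∧ right S y))

    across′ : ∀ x → ∑ (λ y → mult G₂ (N ↑ʳ x) (y ↑ˡ N) when (right S x ∧ left S y))
                    ≡ (D ∸ deg G x) when (left S x ∧ right S x)
    across′ x =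
      trans (∑-cong λ y → trans (cong (_when (right S x ∧ left S y)) (mult-↑ʳ↑ˡ x y))
                                (when-comm (D ∸ deg G y) (does (y ≟ x)) (right S x ∧ left S y)))
        (trans (∑-pick′ x λ y → (D ∸ deg G y) when (right S x ∧ left S y))
               (cong ((D ∸ deg G x) when_) (∧-comm (right S x) (left S x))))

  degreeSumBound-doubled⇒ : ∀ {b} → DegreeSumBound G₂ b → DegreeSumBound G b
  degreeSumBound-doubled⇒ {b} bound₂ X =
    subst₂ (λ t s → t ≤ 2 * (b * ⌊ s /2⌋)) inducedDegreeSum-S size-S (bound₂ S)
    where
    S : Fin (N + N) → Bool
    S a = [ X , const false ]′ (splitAt N a)

    left-S : ∀ x → left S x ≡ X x
    left-S x rewrite splitAt-↑ˡ N x N = refl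

    right-S : ∀ x → right S x ≡ false
    right-S x rewrite splitAt-↑ʳ N N x = refl

    no-deficit : deficit G D (left S ∩ right S) ≡ 0
    no-deficit = trans (∑-cong λ x → cong ((D ∸ deg G x) when_)
      (trans (cong (left S x ∧_) (right-S x)) (∧-zeroʳ (left S x)))) (∑-zero N)

    inducedDegreeSum-S : inducedDegreeSum G₂ S ≡ inducedDegreeSum G X
    inducedDegreeSum-S = begin
      inducedDegreeSum G₂ S
        ≡⟨ inducedDegreeSum-doubled S ⟩
      (inducedDegreeSum G (left S) + deficit G D (left S ∩ right S))
      + (deficit G D (left S ∩ right S) + inducedDegreeSum G (right S))
        ≡⟨ cong₂ _+_ (cong₂ _+_ (inducedDegreeSum-cong G left-S) no-deficit)
                     (cong₂ _+_ no-deficit (trans (inducedDegreeSum-cong G right-S) (∑₂-zero N N))) ⟩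
      inducedDegreeSum G X + 0 + 0
        ≡⟨ trans (+-identityʳ _) (+-identityʳ _) ⟩
      inducedDegreeSum G X ∎
      where open ≡-Reasoning

    size-S : size S ≡ size X
    size-S = trans (∑-split N N _)
      (trans (cong₂ _+_ (∑-cong (cong (1 when_) ∘ left-S))
                        (trans (∑-cong (cong (1 when_) ∘ right-S)) (∑-zero N)))
             (+-identityʳ _))

  degreeSumBound-doubled : DegreeSumBound G D → Δ G ≤ D → DegreeSumBound G₂ D
  degreeSumBound-doubled boundG Δ≤D S = begin
    inducedDegreeSum G₂ S
      ≡⟨ inducedDegreeSum-doubled S ⟩
    (T A + K) + (K + T B)
      ≡⟨ arrange₁ (T A) (T B) K ⟩
    (T A + T B) + (K + K)
      ≤⟨ +-monoˡ-≤ (K + K) (inducedDegreeSum-overlap G A B) ⟩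
    ((T (A ∖ B) + T (B ∖ A)) + (vol G C + vol G C)) + (K + K)
      ≡⟨ arrange₂ (T (A ∖ B) + T (B ∖ A)) (vol G C) K ⟩
    (T (A ∖ B) + T (B ∖ A)) + ((vol G C + K) + (vol G C + K))
      ≡⟨ cong (λ t → (T (A ∖ B) + T (B ∖ A)) + (t + t)) (vol+deficit G (deg≤D Δ≤D) C) ⟩
    (T (A ∖ B) + T (B ∖ A)) + (D * c + D * c)
      ≤⟨ +-monoˡ-≤ (D * c + D * c) (+-mono-≤ (boundG (A ∖ B)) (boundG (B ∖ A))) ⟩
    (2 * (D * ⌊ size (A ∖ B) /2⌋) + 2 * (D * ⌊ size (B ∖ A) /2⌋)) + (D * c + D * c)
      ≡⟨ arrange₃ D ⌊ size (A ∖ B) /2⌋ ⌊ size (B ∖ A) /2⌋ c ⟩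
    2 * (D * (⌊ size (A ∖ B) /2⌋ + ⌊ size (B ∖ A) /2⌋ + c))
      ≤⟨ *-monoʳ-≤ 2 (*-monoʳ-≤ D halves) ⟩
    2 * (D * ⌊ size S /2⌋) ∎
    where
    open ≤-Reasoning

    T : (Fin N → Bool) → ℕ
    T = inducedDegreeSum G

    A B C : Fin N → Bool
    A = left S
    B = right S
    C = A ∩ B

    K c : ℕ
    K = deficit G D C
    c = size C

    arrange₁ : ∀ a b k → (a + k) + (k + b) ≡ (a + b) + (k + k)
    arrange₁ = solve-∀

    arrange₂ : ∀ t v k → (t + (v + v)) + (k + k) ≡ t + ((v + k) + (v + k))
    arrange₂ = solve-∀

    arrange₃ : ∀ d p q r → (2 * (d * p) + 2 * (d * q)) + (d * r + d * r) ≡ 2 * (d * (p + q + r))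
    arrange₃ = solve-∀

    halves : ⌊ size (A ∖ B) /2⌋ + ⌊ size (B ∖ A) /2⌋ + c ≤ ⌊ size S /2⌋
    halves = begin
      ⌊ size (A ∖ B) /2⌋ + ⌊ size (B ∖ A) /2⌋ + c
        ≤⟨ +-monoˡ-≤ c (⌊m/2⌋+⌊n/2⌋≤⌊m+n/2⌋ (size (A ∖ B)) (size (B ∖ A))) ⟩
      ⌊ size (A ∖ B) + size (B ∖ A) /2⌋ + c
        ≡⟨ +-comm _ c ⟩
      c + ⌊ size (A ∖ B) + size (B ∖ A) /2⌋
        ≡⟨ sym (⌊[n+n]+m/2⌋≡n+⌊m/2⌋ c _) ⟩
      ⌊ (c + c) + (size (A ∖ B) + size (B ∖ A)) /2⌋
        ≡⟨ cong ⌊_/2⌋ (trans (+-comm (c + c) _) (sym (trans (∑-split N N _) (size-overlap A B)))) ⟩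
      ⌊ size S /2⌋ ∎

  densityBound-doubled⇒ : ∀ {b} → DensityBound G₂ b → DensityBound G b
  densityBound-doubled⇒ {b} bound =
    degreeSumBound⇒densityBound G (degreeSumBound-doubled⇒ {b} (densityBound⇒degreeSumBound G₂ bound))

  densityBound-doubled : ∀ {w} → DensityBound G w → w ≤ D → Δ G ≤ D → DensityBound G₂ D
  densityBound-doubled boundG w≤D Δ≤D = degreeSumBound⇒densityBound G₂
    (degreeSumBound-doubled (degreeSumBound-mono G (densityBound⇒degreeSumBound G boundG) w≤D) Δ≤D)

someVertex : ∀ G {w} → IsDensity G w → ¬ (Regular G × w ≤ Δ G) → Fin (n G)
someVertex record { n = zero  } (_ , least) irregular = ⊥-elim (irregular ((λ ()) , least 0 (λ _ ())))
someVertex record { n = suc _ } _           _         = zero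

density-doubled : ∀ G {w w′} → IsDensity G w → IsDensity (doubled G (Δ G ⊔ w)) w′ → Fin (n G) →
  (w ≤ w′ × w′ ≤ w ⊔ Δ G) × Δ (doubled G (Δ G ⊔ w)) ≡ Δ G ⊔ w
density-doubled G {w} {w′} (boundG , leastG) (bound₂ , least₂) x =
  ( leastG w′ (densityBound-doubled⇒ bound₂)
  , subst (w′ ≤_) (⊔-comm (Δ G) w)
      (least₂ (Δ G ⊔ w) (densityBound-doubled boundG (m≤n⊔m (Δ G) w) (m≤m⊔n (Δ G) w))) )
  , Δ-doubled (m≤m⊔n (Δ G) w) x
  where open Doubled G (Δ G ⊔ w)

mainTheorem3 : (G : Multigraph) (w : ℕ) → IsDensity G w → (w' : ℕ) → IsDensity (R G w) w' → (w ≤ w' × w' ≤ w ⊔ Δ G) × Δ (R G w) ≡ Δ G ⊔ w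
mainTheorem3 G w ωG w' ωR with regular? G | w ≤? Δ G
... | yes _         | yes w≤Δ =
  (proj₂ ωG w' (proj₁ ωR) , ≤-trans (proj₂ ωR w (proj₁ ωG)) (m≤m⊔n w (Δ G))) , sym (m≥n⇒m⊔n≡m w≤Δ)
... | yes _         | no  w≰Δ = density-doubled G ωG ωR (someVertex G ωG (w≰Δ ∘ proj₂))
... | no  irregular | _       = density-doubled G ωG ωR (someVertex G ωG (irregular ∘ proj₁))
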